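{- Let $m\ge5$ be odd. Let $a,b\in\mathbb Z_m$ with $0\le b\le m-2$ and $s=a+b\ne0$, and let $w(a,b)=(0,a,b,0,-s)\in A_m$. Then \[ G^m(w(a,b))=(-2,\ a+1,\ b+1,\ 0,\ -s). \]
   Context: Indices in $\mathbb Z_5=\{0,\dots,4\}$. $A_m=\{w\in(\mathbb Z_m)^5:\sum_i w_i=0\}$; $e_i$ standard basis vectors; $q_i=e_i-e_4$ ($i=0,1,2,3$), $q_4=0$. For $w\in A_m$, $Z(w)=\{i:w_i=0\}$. The selector $p$ on zero-sets is: $p(\varnothing)=0$; $p(\{0\})=p(\{1\})=p(\{2\})=0$, $p(\{3\})=4$, $p(\{4\})=1$; $p(\{0,1\})=0$, $p(\{0,2\})=0$, $p(\{0,3\})=2$, $p(\{0,4\})=1$, $p(\{1,2\})=4$, $p(\{1,3\})=4$, $p(\{1,4\})=1$, $p(\{2,3\})=1$, $p(\{2,4\})=3$, $p(\{3,4\})=4$; $p(\{0,1,2\})=4$, $p(\{0,1,3\})=2$, $p(\{0,1,4\})=1$, $p(\{0,2,3\})=2$, $p(\{0,2,4\})=3$, $p(\{0,3,4\})=1$, $p(\{1,2,3\})=1$, $p(\{1,2,4\})=4$, $p(\{1,3,4\})=4$, $p(\{2,3,4\})=3$; $p(\{0,1,2,3,4\})=0$ (no point of $A_m$ has a four-element zero-set). $G:A_m\to A_m$ is $G(w)=w-3q_0+q_3+q_{p(Z(w))}=w+(-3,0,0,1,1)+e_{p(Z(w))}$. -}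

module Defs where

open import Data.Nat as ℕ using (ℕ; zero; suc; NonZero)
open import Data.Nat.DivMod using (_%_)
open import Data.Fin as Fin using (Fin; toℕ; fromℕ<)
open import Data.Nat.DivMod using (m%n<n)
open import Data.Bool using (Bool; true; false)
open import Data.Vec using (Vec; []; _∷_)
open import Relation.Nullary using (does)
open import Data.Fin.Properties using () renaming (_≟_ to _≟F_)

module _ (m : ℕ) .{{_ : NonZero m}} where

  Zm : Set
  Zm = Fin m

  [_] : ℕ → Zm
  [ k ] = fromℕ< (m%n<n k m)

  infixl 6 _⊕_ _⊖_
  _⊕_ : Zm → Zm → Zm
  x ⊕ y = [ toℕ x ℕ.+ toℕ y ]

  ⊝_ : Zm → Zm
  ⊝ x = [ m ℕ.∸ toℕ x ]

  _⊖_ : Zm → Zm → Zm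
  x ⊖ y = x ⊕ (⊝ y)

  Pt : Set
  Pt = Fin 5 → Zm

  inA : Pt → Set
  inA w = (w Fin.zero ⊕ w (Fin.suc Fin.zero) ⊕ w (Fin.suc (Fin.suc Fin.zero))
             ⊕ w (Fin.suc (Fin.suc (Fin.suc Fin.zero)))
             ⊕ w (Fin.suc (Fin.suc (Fin.suc (Fin.suc Fin.zero))))) ≡ [ 0 ]
    where open import Relation.Binary.PropositionalEquality using (_≡_)

  -- zero-set Z(w) as a characteristic vector (entry i is true iff w_i = 0)
  isZero : Zm → Bool
  isZero x = does (x ≟F [ 0 ])

  Z : Pt → Vec Bool 5
  Z w = isZero (w Fin.zero) ∷ isZero (w (Fin.suc Fin.zero))
      ∷ isZero (w (Fin.suc (Fin.suc Fin.zero)))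
      ∷ isZero (w (Fin.suc (Fin.suc (Fin.suc Fin.zero))))
      ∷ isZero (w (Fin.suc (Fin.suc (Fin.suc (Fin.suc Fin.zero))))) ∷ []

i0 i1 i2 i3 i4 : Fin 5
i0 = Fin.zero
i1 = Fin.suc Fin.zero
i2 = Fin.suc (Fin.suc Fin.zero)
i3 = Fin.suc (Fin.suc (Fin.suc Fin.zero))
i4 = Fin.suc (Fin.suc (Fin.suc (Fin.suc Fin.zero)))

-- The selector p on zero-sets (characteristic vectors z0 z1 z2 z3 z4).
-- Zero-sets of size 4 never occur in A_m; they are sent to 0 arbitrarily.
p : Vec Bool 5 → Fin 5
p (false ∷ false ∷ false ∷ false ∷ false ∷ []) = i0
p (true ∷ false ∷ false ∷ false ∷ false ∷ []) = i0
p (false ∷ true ∷ false ∷ false ∷ false ∷ []) = i0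
p (false ∷ false ∷ true ∷ false ∷ false ∷ []) = i0
p (false ∷ false ∷ false ∷ true ∷ false ∷ []) = i4
p (false ∷ false ∷ false ∷ false ∷ true ∷ []) = i1
p (true ∷ true ∷ false ∷ false ∷ false ∷ []) = i0
p (true ∷ false ∷ true ∷ false ∷ false ∷ []) = i0
p (true ∷ false ∷ false ∷ true ∷ false ∷ []) = i2
p (true ∷ false ∷ false ∷ false ∷ true ∷ []) = i1
p (false ∷ true ∷ true ∷ false ∷ false ∷ []) = i4
p (false ∷ true ∷ false ∷ true ∷ false ∷ []) = i4
p (false ∷ true ∷ false ∷ false ∷ true ∷ []) = i1
p (false ∷ false ∷ true ∷ true ∷ false ∷ []) = i1
p (false ∷ false ∷ true ∷ false ∷ true ∷ []) = i3
p (false ∷ false ∷ false ∷ true ∷ true ∷ []) = i4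
p (true ∷ true ∷ true ∷ false ∷ false ∷ []) = i4
p (true ∷ true ∷ false ∷ true ∷ false ∷ []) = i2
p (true ∷ true ∷ false ∷ false ∷ true ∷ []) = i1
p (true ∷ false ∷ true ∷ true ∷ false ∷ []) = i2
p (true ∷ false ∷ true ∷ false ∷ true ∷ []) = i3
p (true ∷ false ∷ false ∷ true ∷ true ∷ []) = i1
p (false ∷ true ∷ true ∷ true ∷ false ∷ []) = i1
p (false ∷ true ∷ true ∷ false ∷ true ∷ []) = i4
p (false ∷ true ∷ false ∷ true ∷ true ∷ []) = i4
p (false ∷ false ∷ true ∷ true ∷ true ∷ []) = i3
p (true ∷ true ∷ true ∷ true ∷ true ∷ []) = i0
p _ = i0

module _ (m : ℕ) .{{_ : NonZero m}} where

  e : Fin 5 → Pt m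
  e j i = Data.Bool.if does (i ≟F j) then [ m ] 1 else [ m ] 0

  shift : Pt m
  shift i0' = base i0'
    where
      base : Fin 5 → Zm m
      base Fin.zero = ⊝_ m ([ m ] 3)
      base (Fin.suc Fin.zero) = [ m ] 0
      base (Fin.suc (Fin.suc Fin.zero)) = [ m ] 0
      base (Fin.suc (Fin.suc (Fin.suc _))) = [ m ] 1

  G : Pt m → Pt m
  G w i = _⊕_ m (_⊕_ m (w i) (shift i)) (e (p (Z m w)) i)

  iter : ℕ → Pt m → Pt m
  iter zero w = w
  iter (suc n) w = G (iter n w)

module _ (m : ℕ) .{{_ : NonZero m}} where

  wab : Zm m → Zm m → Pt m
  wab a b Fin.zero = [ m ] 0
  wab a b (Fin.suc Fin.zero) = a
  wab a b (Fin.suc (Fin.suc Fin.zero)) = b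
  wab a b (Fin.suc (Fin.suc (Fin.suc Fin.zero))) = [ m ] 0
  wab a b (Fin.suc (Fin.suc (Fin.suc (Fin.suc Fin.zero)))) = ⊝_ m (_⊕_ m a b)

  target : Zm m → Zm m → Pt m
  target a b Fin.zero = ⊝_ m ([ m ] 2)
  target a b (Fin.suc Fin.zero) = _⊕_ m a ([ m ] 1)
  target a b (Fin.suc (Fin.suc Fin.zero)) = _⊕_ m b ([ m ] 1)
  target a b (Fin.suc (Fin.suc (Fin.suc Fin.zero))) = [ m ] 0
  target a b (Fin.suc (Fin.suc (Fin.suc (Fin.suc Fin.zero)))) = ⊝_ m (_⊕_ m a b)

-- Along the orbit the selector only ever sees coordinates 2, 3 and 4. At time 0 the zero-set
-- contains 0 and 3 but not 4 (as s ≠ 0), so p selects 2; from then on coordinate 2 is b + 1 ≠ 0,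
-- coordinate 3 is the time t and coordinate 4 is t − s. Hence p selects 0 at every later step
-- except at t = s, where coordinate 4 vanishes and p selects 1. Adding up the m increments gives
-- −3m + (m − 2) ≡ −2 in coordinate 0, one unit in coordinates 1 and 2, and m ≡ 0 in 3 and 4.
-- Since coordinate 0 never influences these selections, the oddness of m is not needed.
module Submission where

open import Defs
open import Data.Nat using (ℕ; NonZero; _≤_; _∸_)
open import Data.Nat.Divisibility using (_∣_)
open import Data.Fin using (Fin; toℕ)
open import Relation.Nullary using (¬_)
open import Relation.Binary.PropositionalEquality using (_≡_; _≢_)

open import Data.Nat using (zero; suc; _+_; _*_; _<_; _%_; z≤n; s≤s; >-nonZero⁻¹)
open import Data.Nat.Properties
  using (+-comm; +-suc; *-comm; m+n∸m≡n; m≤m+n; m≤n+m; m≤o∸n⇒m+n≤o; m≤n⇒∃[o]m+o≡n;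
         ≤-trans; ≤-reflexive; <-trans; <-≤-trans; +-monoˡ-<; m<n⇒m<1+n; n<1+n)
open import Data.Nat.DivMod using (%-distribˡ-+; m<n⇒m%n≡m; [m+kn]%n≡m%n; [m+n]%n≡m%n; n%n≡0)
open import Data.Nat.Tactic.RingSolver using (solve-∀)
open import Data.Fin.Patterns using (0F; 1F; 2F; 3F; 4F)
open import Data.Fin.Properties using (toℕ-injective; toℕ-fromℕ<; toℕ<n) renaming (_≟_ to _≟F_)
open import Data.Bool using (true; false; _∧_; if_then_else_)
open import Data.Vec using ([]; _∷_)
open import Data.Product using (_,_)
open import Relation.Nullary using (does; yes; no; contradiction)
open import Relation.Nullary.Decidable using (dec-true; dec-false)
open import Relation.Binary.PropositionalEquality
  using (refl; sym; trans; cong; cong₂; _≗_; module ≡-Reasoning)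

module Residue (m : ℕ) .{{_ : NonZero m}} where

  toℕ-[] : ∀ n → toℕ ([ m ] n) ≡ n % m
  toℕ-[] n = toℕ-fromℕ< _

  toℕ-[]-< : ∀ {n} → n < m → toℕ ([ m ] n) ≡ n
  toℕ-[]-< {n} n<m = trans (toℕ-[] n) (m<n⇒m%n≡m n<m)

  0%m≡0 : 0 % m ≡ 0
  0%m≡0 = m<n⇒m%n≡m (>-nonZero⁻¹ m)

  toℕ-[0] : toℕ ([ m ] 0) ≡ 0
  toℕ-[0] = trans (toℕ-[] 0) 0%m≡0

  %-≡⇒[]-≡ : ∀ {x y} → x % m ≡ y % m → [ m ] x ≡ [ m ] y
  %-≡⇒[]-≡ {x} {y} eq = toℕ-injective (trans (toℕ-[] x) (trans eq (sym (toℕ-[] y))))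

  [toℕ] : (x : Zm m) → [ m ] (toℕ x) ≡ x
  [toℕ] x = toℕ-injective (toℕ-[]-< (toℕ<n x))

  ⊕-[] : ∀ x y → _⊕_ m ([ m ] x) ([ m ] y) ≡ [ m ] (x + y)
  ⊕-[] x y = %-≡⇒[]-≡ (trans (cong₂ (λ r s → (r + s) % m) (toℕ-[] x) (toℕ-[] y))
                               (sym (%-distribˡ-+ x y m)))

  [m]≡[0] : [ m ] m ≡ [ m ] 0
  [m]≡[0] = %-≡⇒[]-≡ (trans (n%n≡0 m) (sym 0%m≡0))

  [n+m]≡[n] : ∀ n → [ m ] (n + m) ≡ [ m ] n
  [n+m]≡[n] n = %-≡⇒[]-≡ ([m+n]%n≡m%n n m)

  [m*k+n]≡[n] : ∀ k n → [ m ] (m * k + n) ≡ [ m ] n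
  [m*k+n]≡[n] k n = %-≡⇒[]-≡ (trans (cong (_% m) (trans (+-comm (m * k) n) (cong (n +_) (*-comm m k))))
                                     ([m+kn]%n≡m%n n k m))

  isZero-[]≡true : ∀ {n} → n % m ≡ 0 → isZero m ([ m ] n) ≡ true
  isZero-[]≡true n%m≡0 = dec-true (_ ≟F _) (%-≡⇒[]-≡ (trans n%m≡0 (sym 0%m≡0)))

  isZero-[suc]≡false : ∀ {n} → suc n < m → isZero m ([ m ] (suc n)) ≡ false
  isZero-[suc]≡false n<m = dec-false (_ ≟F _) λ eq →
    contradiction (trans (sym (toℕ-[]-< n<m)) (trans (cong toℕ eq) toℕ-[0])) λ ()

  isZero-∧-isZero≡false : ∀ x y → _⊕_ m x y ≢ [ m ] 0 → isZero m x ∧ isZero m y ≡ false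
  isZero-∧-isZero≡false x y x⊕y≢0 with x ≟F [ m ] 0 | y ≟F [ m ] 0
  ... | yes refl | yes refl = contradiction (⊕-[] 0 0) x⊕y≢0
  ... | yes _    | no _     = refl
  ... | no _     | _        = refl

p[Z⊆01]≡0 : ∀ {z₀ z₁ z₂ z₃ z₄} → z₂ ≡ false → z₃ ≡ false → z₄ ≡ false →
            p (z₀ ∷ z₁ ∷ z₂ ∷ z₃ ∷ z₄ ∷ []) ≡ i0
p[Z⊆01]≡0 {true}  {true}  refl refl refl = refl
p[Z⊆01]≡0 {true}  {false} refl refl refl = refl
p[Z⊆01]≡0 {false} {true}  refl refl refl = refl
p[Z⊆01]≡0 {false} {false} refl refl refl = refl

p[4∈Z⊆014]≡1 : ∀ {z₀ z₁ z₂ z₃ z₄} → z₂ ≡ false → z₃ ≡ false → z₄ ≡ true →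
               p (z₀ ∷ z₁ ∷ z₂ ∷ z₃ ∷ z₄ ∷ []) ≡ i1
p[4∈Z⊆014]≡1 {true}  {true}  refl refl refl = refl
p[4∈Z⊆014]≡1 {true}  {false} refl refl refl = refl
p[4∈Z⊆014]≡1 {false} {true}  refl refl refl = refl
p[4∈Z⊆014]≡1 {false} {false} refl refl refl = refl

p[03∈Z∌4]≡2 : ∀ {z₀ z₁ z₂ z₃ z₄} → z₀ ≡ true → z₃ ≡ true → z₄ ≡ false → z₁ ∧ z₂ ≡ false →
              p (z₀ ∷ z₁ ∷ z₂ ∷ z₃ ∷ z₄ ∷ []) ≡ i2
p[03∈Z∌4]≡2 {z₁ = true}  {false} refl refl refl refl = refl
p[03∈Z∌4]≡2 {z₁ = false} {true}  refl refl refl refl = refl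
p[03∈Z∌4]≡2 {z₁ = false} {false} refl refl refl refl = refl

module Dynamics (m : ℕ) .{{_ : NonZero m}} where
  open Residue m

  mk : (Fin 5 → ℕ) → Pt m
  mk c i = [ m ] (c i)

  neg3 : ℕ
  neg3 = m ∸ toℕ ([ m ] 3)

  shiftℕ : Fin 5 → ℕ
  shiftℕ 0F = neg3
  shiftℕ 1F = 0
  shiftℕ 2F = 0
  shiftℕ 3F = 1
  shiftℕ 4F = 1

  eℕ : Fin 5 → Fin 5 → ℕ
  eℕ j i = if does (i ≟F j) then 1 else 0

  stepℕ : Fin 5 → Fin 5 → ℕ
  stepℕ j i = shiftℕ i + eℕ j i

  shift≗mk : shift m ≗ mk shiftℕ
  shift≗mk 0F = refl
  shift≗mk 1F = refl
  shift≗mk 2F = refl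
  shift≗mk 3F = refl
  shift≗mk 4F = refl

  e≗mk : ∀ j → e m j ≗ mk (eℕ j)
  e≗mk j i with does (i ≟F j)
  ... | true  = refl
  ... | false = refl

  Z-cong : ∀ {w w′} → w ≗ w′ → Z m w ≡ Z m w′
  Z-cong {w} {w′} w≗w′ =
    cong₂ _∷_ (isZero≡ 0F) (cong₂ _∷_ (isZero≡ 1F) (cong₂ _∷_ (isZero≡ 2F)
      (cong₂ _∷_ (isZero≡ 3F) (cong₂ _∷_ (isZero≡ 4F) refl))))
    where
      isZero≡ : ∀ i → isZero m (w i) ≡ isZero m (w′ i)
      isZero≡ i = cong (isZero m) (w≗w′ i)

  G-step : ∀ {w c c′} j → w ≗ mk c → p (Z m (mk c)) ≡ j →
           (∀ i → stepℕ j i + c i ≡ c′ i) → G m w ≗ mk c′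
  G-step {w} {c} {c′} j w≗c selects-j c+step≡c′ i = begin
    _⊕_ m (_⊕_ m (w i) (shift m i)) (e m (p (Z m w)) i)
      ≡⟨ cong₂ (λ x k → _⊕_ m (_⊕_ m x (shift m i)) (e m k i)) (w≗c i) (trans (cong p (Z-cong w≗c)) selects-j) ⟩
    _⊕_ m (_⊕_ m (mk c i) (shift m i)) (e m j i)
      ≡⟨ cong₂ (λ x y → _⊕_ m (_⊕_ m (mk c i) x) y) (shift≗mk i) (e≗mk j i) ⟩
    _⊕_ m (_⊕_ m (mk c i) (mk shiftℕ i)) (mk (eℕ j) i)
      ≡⟨ cong (λ x → _⊕_ m x (mk (eℕ j) i)) (⊕-[] (c i) (shiftℕ i)) ⟩
    _⊕_ m ([ m ] (c i + shiftℕ i)) (mk (eℕ j) i)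
      ≡⟨ ⊕-[] (c i + shiftℕ i) (eℕ j i) ⟩
    [ m ] (c i + shiftℕ i + eℕ j i)
      ≡⟨ cong [ m ] (trans (reorder (c i) (shiftℕ i) (eℕ j i)) (c+step≡c′ i)) ⟩
    mk c′ i ∎
    where
      open ≡-Reasoning
      reorder : ∀ x y z → x + y + z ≡ (y + z) + x
      reorder = solve-∀

  iter-phase : ∀ j (f : ℕ → Fin 5 → ℕ) → (∀ k i → stepℕ j i + f k i ≡ f (suc k) i) →
               ∀ n → (∀ k → k < n → p (Z m (mk (f k))) ≡ j) →
               ∀ {w} → w ≗ mk (f 0) → iter m n w ≗ mk (f n)
  iter-phase j f f-step zero    selects w≗f₀ = w≗f₀
  iter-phase j f f-step (suc n) selects w≗f₀ =
    G-step j (iter-phase j f f-step n (λ k k<n → selects k (m<n⇒m<1+n k<n)) w≗f₀)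
             (selects n (n<1+n n)) (f-step n)

  iter-+ : ∀ n k w → iter m (n + k) w ≡ iter m n (iter m k w)
  iter-+ zero    k w = refl
  iter-+ (suc n) k w = cong (G m) (iter-+ n k w)

  tick : ∀ c δ t z → (c + δ) + (t * c + z) ≡ suc t * c + (δ + z)
  tick = solve-∀

module Orbit (m : ℕ) .{{_ : NonZero m}} (a b : Zm m) (u v : ℕ)
             (s≡1+u : toℕ (_⊕_ m a b) ≡ suc u) (m≡2+u+v : suc (suc (u + v)) ≡ m)
             (1+b<m : suc (toℕ b) < m) (2<m : 2 < m) where
  open Residue m
  open Dynamics m

  m≡2+v+u : suc (suc (v + u)) ≡ m
  m≡2+v+u = trans (cong (λ n → suc (suc n)) (+-comm v u)) m≡2+u+v

  m∸s≡1+v : m ∸ toℕ (_⊕_ m a b) ≡ suc v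
  m∸s≡1+v = begin
    m ∸ toℕ (_⊕_ m a b)         ≡⟨ cong₂ _∸_ (sym m≡2+u+v) s≡1+u ⟩
    suc (u + v) ∸ u             ≡⟨ cong (_∸ u) (sym (+-suc u v)) ⟩
    u + suc v ∸ u               ≡⟨ m+n∸m≡n u (suc v) ⟩
    suc v ∎
    where open ≡-Reasoning

  1+u<m : suc u < m
  1+u<m = <-≤-trans (s≤s (s≤s (m≤m+n u v))) (≤-reflexive m≡2+u+v)

  1+v<m : suc v < m
  1+v<m = <-≤-trans (s≤s (s≤s (m≤n+m v u))) (≤-reflexive m≡2+u+v)

  a⊕b≢0 : _⊕_ m a b ≢ [ m ] 0
  a⊕b≢0 eq = contradiction (trans (sym s≡1+u) (trans (cong toℕ eq) toℕ-[0])) λ ()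

  initial : Fin 5 → ℕ
  initial 0F = 0
  initial 1F = toℕ a
  initial 2F = toℕ b
  initial 3F = 0
  initial 4F = suc v

  -- before k is the state at time 1 + k (k ≤ u) and after k the state at time 2 + u + k;
  -- coordinate 0 is written as time · neg3 + (number of steps so far that selected 0).
  before : ℕ → Fin 5 → ℕ
  before k 0F = suc k * neg3 + k
  before k 1F = toℕ a
  before k 2F = suc (toℕ b)
  before k 3F = suc k
  before k 4F = suc (suc (k + v))

  after : ℕ → Fin 5 → ℕ
  after k 0F = suc (suc (k + u)) * neg3 + (k + u)
  after k 1F = suc (toℕ a)
  after k 2F = suc (toℕ b)
  after k 3F = suc (suc (k + u))
  after k 4F = suc (suc (suc (k + (u + v))))

  wab≗initial : wab m a b ≗ mk initial
  wab≗initial 0F = refl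
  wab≗initial 1F = sym ([toℕ] a)
  wab≗initial 2F = sym ([toℕ] b)
  wab≗initial 3F = refl
  wab≗initial 4F = cong [ m ] m∸s≡1+v

  initial-selects-2 : p (Z m (mk initial)) ≡ i2
  initial-selects-2 =
    p[03∈Z∌4]≡2 (isZero-[]≡true 0%m≡0) (isZero-[]≡true 0%m≡0)
                (isZero-[suc]≡false 1+v<m)
                (isZero-∧-isZero≡false ([ m ] (toℕ a)) ([ m ] (toℕ b)) λ eq →
                  a⊕b≢0 (trans (sym (cong₂ (_⊕_ m) ([toℕ] a) ([toℕ] b))) eq))

  initial-step : ∀ i → stepℕ i2 i + initial i ≡ before 0 i
  initial-step 0F = refl
  initial-step 1F = refl
  initial-step 2F = refl
  initial-step 3F = refl
  initial-step 4F = refl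

  before-step : ∀ k i → stepℕ i0 i + before k i ≡ before (suc k) i
  before-step k 0F = tick neg3 1 (suc k) k
  before-step k 1F = refl
  before-step k 2F = refl
  before-step k 3F = refl
  before-step k 4F = refl

  before-selects-0 : ∀ k → k < u → p (Z m (mk (before k))) ≡ i0
  before-selects-0 k k<u =
    p[Z⊆01]≡0 (isZero-[suc]≡false 1+b<m)
              (isZero-[suc]≡false (<-trans (s≤s k<u) 1+u<m))
              (isZero-[suc]≡false (<-≤-trans (s≤s (s≤s (+-monoˡ-< v k<u))) (≤-reflexive m≡2+u+v)))

  wrap-selects-1 : p (Z m (mk (before u))) ≡ i1
  wrap-selects-1 =
    p[4∈Z⊆014]≡1 (isZero-[suc]≡false 1+b<m)
                 (isZero-[suc]≡false 1+u<m)
                 (isZero-[]≡true (trans (cong (_% m) m≡2+u+v) (n%n≡0 m)))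

  wrap-step : ∀ i → stepℕ i1 i + before u i ≡ after 0 i
  wrap-step 0F = tick neg3 0 (suc u) u
  wrap-step 1F = refl
  wrap-step 2F = refl
  wrap-step 3F = refl
  wrap-step 4F = refl

  after-step : ∀ k i → stepℕ i0 i + after k i ≡ after (suc k) i
  after-step k 0F = tick neg3 1 (suc (suc (k + u))) (k + u)
  after-step k 1F = refl
  after-step k 2F = refl
  after-step k 3F = refl
  after-step k 4F = refl

  after-4≡1+k+m : ∀ k → after k i4 ≡ suc k + m
  after-4≡1+k+m k = begin
    suc (suc (suc (k + (u + v))))  ≡⟨ cong suc (sym (trans (+-suc k _) (cong suc (+-suc k _)))) ⟩
    suc k + suc (suc (u + v))      ≡⟨ cong (suc k +_) m≡2+u+v ⟩
    suc k + m ∎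
    where open ≡-Reasoning

  after-selects-0 : ∀ k → k < v → p (Z m (mk (after k))) ≡ i0
  after-selects-0 k k<v =
    p[Z⊆01]≡0 (isZero-[suc]≡false 1+b<m)
              (isZero-[suc]≡false (<-≤-trans (s≤s (s≤s (+-monoˡ-< u k<v))) (≤-reflexive m≡2+v+u)))
              (trans (cong (isZero m) (trans (cong [ m ] (after-4≡1+k+m k)) ([n+m]≡[n] (suc k))))
                     (isZero-[suc]≡false (<-trans (s≤s k<v) 1+v<m)))

  [suc]≡⊕[1] : ∀ x → [ m ] (suc x) ≡ [ m ] (x + toℕ ([ m ] 1))
  [suc]≡⊕[1] x = cong [ m ] (trans (+-comm 1 x) (cong (x +_) (sym (toℕ-[]-< (≤-trans (s≤s (s≤s z≤n)) 2<m)))))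

  after-v≗target : mk (after v) ≗ target m a b
  after-v≗target 0F = begin
    [ m ] (suc (suc (v + u)) * neg3 + (v + u))  ≡⟨ cong (λ t → [ m ] (t * neg3 + (v + u))) m≡2+v+u ⟩
    [ m ] (m * neg3 + (v + u))                  ≡⟨ [m*k+n]≡[n] neg3 (v + u) ⟩
    [ m ] (v + u)                               ≡⟨ cong (λ n → [ m ] (n ∸ 2)) m≡2+v+u ⟩
    [ m ] (m ∸ 2)                               ≡⟨ cong (λ n → [ m ] (m ∸ n)) (sym (toℕ-[]-< 2<m)) ⟩
    ⊝_ m ([ m ] 2) ∎
    where open ≡-Reasoning
  after-v≗target 1F = [suc]≡⊕[1] (toℕ a)
  after-v≗target 2F = [suc]≡⊕[1] (toℕ b)
  after-v≗target 3F = trans (cong [ m ] m≡2+v+u) [m]≡[0]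
  after-v≗target 4F = trans (cong [ m ] (after-4≡1+k+m v)) (trans ([n+m]≡[n] (suc v)) (cong [ m ] (sym m∸s≡1+v)))

  iter-m≡phases : ∀ w → iter m m w ≡ iter m v (G m (iter m u (G m w)))
  iter-m≡phases w = begin
    iter m m w                         ≡⟨ cong (λ n → iter m n w) (sym (trans (duration u v) m≡2+u+v)) ⟩
    iter m (v + suc (u + 1)) w         ≡⟨ iter-+ v (suc (u + 1)) w ⟩
    iter m v (G m (iter m (u + 1) w))  ≡⟨ cong (λ x → iter m v (G m x)) (iter-+ u 1 w) ⟩
    iter m v (G m (iter m u (G m w))) ∎
    where
      open ≡-Reasoning
      duration : ∀ u v → v + suc (u + 1) ≡ suc (suc (u + v))
      duration = solve-∀

  iter-m≗target : iter m m (wab m a b) ≗ target m a b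
  iter-m≗target i = trans (cong (λ w → w i) (iter-m≡phases W)) (trans (to-end i) (after-v≗target i))
    where
      W : Pt m
      W = wab m a b
      to-wrap : iter m u (G m W) ≗ mk (before u)
      to-wrap = iter-phase i0 before before-step u before-selects-0
                  (G-step i2 wab≗initial initial-selects-2 initial-step)
      to-end : iter m v (G m (iter m u (G m W))) ≗ mk (after v)
      to-end = iter-phase i0 after after-step v after-selects-0 (G-step i1 to-wrap wrap-selects-1 wrap-step)

mainTheorem6 : (m : ℕ) .{{_ : NonZero m}} → 5 ≤ m → ¬ (2 ∣ m) →
    (a b : Zm m) → toℕ b ≤ m ∸ 2 → _⊕_ m a b ≢ [ m ] 0 →
    (i : Fin 5) → iter m m (wab m a b) i ≡ target m a b i
mainTheorem6 m 5≤m _ a b b≤m∸2 a⊕b≢0 with toℕ (_⊕_ m a b) in s≡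
... | zero  = contradiction (toℕ-injective (trans s≡ (sym (Residue.toℕ-[0] m)))) a⊕b≢0
... | suc u with v , m≡2+u+v ← m≤n⇒∃[o]m+o≡n (toℕ<n (_⊕_ m a b)) =
  Orbit.iter-m≗target m a b u v s≡ (trans (cong (λ s → suc s + v) (sym s≡)) m≡2+u+v) 1+b<m 2<m
  where
    2<m : 2 < m
    2<m = ≤-trans (s≤s (s≤s (s≤s z≤n))) 5≤m
    1+b<m : suc (toℕ b) < m
    1+b<m = ≤-trans (≤-reflexive (+-comm 2 (toℕ b))) (m≤o∸n⇒m+n≤o (toℕ b) (≤-trans (s≤s (s≤s z≤n)) 5≤m) b≤m∸2)
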